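{- For every integer $n\ge 2$, $$ L_P^{opt}(n)\ge \frac{2}{3}\sum_{u\mid n,\ u>1}\frac{1}{u}. $$
   Context: For a positive integer $n\ge 2$, the linear program $(P_n)$ has one real variable $\alpha_u$ for each divisor $u$ of $n$ with $u>1$. It asks to maximize $\ell_P(\alpha)=\sum_{u\mid n,\,u>1}\alpha_u/u$ subject to: $\alpha_u\ge 0$ for all such $u$; $\alpha_u\le 1$ for all such $u$; and $\alpha_u+\alpha_v+\alpha_{uv}\le 2$ for every unordered pair $\{u,v\}$ of divisors of $n$ with $u,v>1$ and $uv\mid n$ (the case $u=v$ is allowed when $u^2\mid n$, giving the constraint $2\alpha_u+\alpha_{u^2}\le 2$). $L_P^{opt}(n)$ denotes the optimal (maximum) value of $(P_n)$. -}

module Defs where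

open import Data.Nat using (ℕ; zero; suc; _<?_; _<_)
open import Data.Nat.Divisibility using (_∣_; _∣?_)
open import Data.Integer using (+_)
open import Data.Rational using (ℚ; 0ℚ; 1ℚ; _+_; _*_; _/_; _≤_)
open import Data.List using (List; filter; upTo; foldr; map)
open import Data.Product using (_×_)
open import Relation.Nullary.Decidable using (_×-dec_)

-- 1/u as a rational (value at 0 is irrelevant; only used for u > 1)
recip : ℕ → ℚ
recip zero    = 0ℚ
recip (suc k) = + 1 / suc k

nontrivialDivisors : ℕ → List ℕ
nontrivialDivisors n = filter (λ u → (1 <? u) ×-dec (u ∣? n)) (upTo (suc n))

sumℚ : List ℚ → ℚ
sumℚ = foldr _+_ 0ℚ

objective : ℕ → (ℕ → ℚ) → ℚ
objective n α = sumℚ (map (λ u → α u * recip u) (nontrivialDivisors n))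

harmonicDiv : ℕ → ℚ
harmonicDiv n = sumℚ (map recip (nontrivialDivisors n))

2ℚ : ℚ
2ℚ = + 2 / 1

-- feasibility for (P_n); α is indexed by ℕ, only values at divisors u>1 matter
Feasible : ℕ → (ℕ → ℚ) → Set
Feasible n α =
  (∀ u → 1 < u → u ∣ n → (0ℚ ≤ α u) × (α u ≤ 1ℚ)) ×
  (∀ u v → 1 < u → 1 < v → u Data.Nat.* v ∣ n →
     α u + α v + α (u Data.Nat.* v) ≤ 2ℚ)

module Submission where

-- The bound is witnessed by the constant vector α_u = 2/3.
--
-- A constant vector α_u = c is feasible for (P_n) as soon as 0 ≤ c ≤ 1 and
-- 3c ≤ 2: the box constraints hold pointwise, and every triangle constraint
-- α_u + α_v + α_{uv} ≤ 2 reads c + c + c ≤ 2 (including the case u = v).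
-- Its objective value is Σ c/u = c · Σ 1/u, because multiplication by a
-- constant distributes over a finite sum.

open import Defs
open import Data.Nat using (ℕ; _≤_)
open import Data.Integer using (+_)
open import Data.Rational using (ℚ; _/_; _*_)
open import Data.Product using (Σ; _×_; _,_)
open import Data.List using (List; []; _∷_; map)
import Data.Rational as ℚ
import Data.Rational.Properties as ℚP
open import Relation.Nullary.Decidable using (toWitness)
open import Relation.Binary.PropositionalEquality using (_≡_; sym; cong)
open Relation.Binary.PropositionalEquality.≡-Reasoning

sumℚ-scale : (c : ℚ) (f : ℕ → ℚ) (us : List ℕ) →
             c * sumℚ (map f us) ≡ sumℚ (map (λ u → c * f u) us)
sumℚ-scale c f []       = ℚP.*-zeroʳ c
sumℚ-scale c f (u ∷ us) = begin
  c * (f u ℚ.+ sumℚ (map f us))                 ≡⟨ ℚP.*-distribˡ-+ c (f u) (sumℚ (map f us)) ⟩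
  c * f u ℚ.+ c * sumℚ (map f us)               ≡⟨ cong (c * f u ℚ.+_) (sumℚ-scale c f us) ⟩
  c * f u ℚ.+ sumℚ (map (λ v → c * f v) us)     ∎

constant-feasible : (n : ℕ) (c : ℚ) →
                    ℚ._≤_ ℚ.0ℚ c → ℚ._≤_ c ℚ.1ℚ → ℚ._≤_ (c ℚ.+ c ℚ.+ c) 2ℚ →
                    Feasible n (λ _ → c)
constant-feasible n c 0≤c c≤1 3c≤2 =
  (λ _ _ _ → 0≤c , c≤1) , (λ _ _ _ _ _ → 3c≤2)

objective-constant : (n : ℕ) (c : ℚ) → objective n (λ _ → c) ≡ c * harmonicDiv n
objective-constant n c = sym (sumℚ-scale c recip (nontrivialDivisors n))

twoThirds : ℚ
twoThirds = + 2 / 3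

0≤twoThirds : ℚ._≤_ ℚ.0ℚ twoThirds
0≤twoThirds = toWitness {a? = ℚ.0ℚ ℚP.≤? twoThirds} _

twoThirds≤1 : ℚ._≤_ twoThirds ℚ.1ℚ
twoThirds≤1 = toWitness {a? = twoThirds ℚP.≤? ℚ.1ℚ} _

3·twoThirds≤2 : ℚ._≤_ (twoThirds ℚ.+ twoThirds ℚ.+ twoThirds) 2ℚ
3·twoThirds≤2 = toWitness {a? = (twoThirds ℚ.+ twoThirds ℚ.+ twoThirds) ℚP.≤? 2ℚ} _

proposition3p2 : (n : ℕ) → 2 ≤ n →
    Σ (ℕ → ℚ) (λ α → Feasible n α ×
    Data.Rational._≤_ ((+ 2 / 3) * harmonicDiv n) (objective n α))
proposition3p2 n _ =
  (λ _ → twoThirds) ,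
  constant-feasible n twoThirds 0≤twoThirds twoThirds≤1 3·twoThirds≤2 ,
  ℚP.≤-reflexive (sym (objective-constant n twoThirds))
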